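{- Let $\Delta=\Delta(X,Y,T,E)$ be a tableau complex and $(x,y)\in E$. The deletion $\mathrm{del}_{v_{(x,y)}}\Delta$ is pure if and only if $v_{(x,y)}$ is a cone vertex of $\Delta$ or $v_{(x,y)}$ is safe.
   Context: Let $X,Y$ be finite sets; a tableau is a function $f:X\to Y$, identified with its graph in $X\times Y$. Let $T$ be a set of tableaux and $E\subseteq X\times Y$ contain every $f\in T$. Put $v_{(x,y)}:=E\setminus\{(x,y)\}$ for $(x,y)\in E$. The tableau complex $\Delta(X,Y,T,E)$ is the simplicial complex on ground set $\{v_{(x,y)}:(x,y)\in E\}$ whose faces are the sets $\{v_{(x,y)}:(x,y)\in E\setminus F\}$ for $F\subseteq E$ containing some $f\in T$; its facets are the $f\in T$. The deletion of $v$ is $\mathrm{del}_v\Delta=\{C\in\Delta: v\notin C\}$. A vertex is a cone vertex if it lies in every facet. The vertex $v_{(x,y)}$ is called safe if for every $f\in T$, changing the value of $f$ at $x$ from $f(x)$ to $y$ yields a tableau that again lies in $T$. -}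

module Defs where

open import Data.Nat using (ℕ; _+_)
open import Data.Bool using (Bool; true; false)
open import Data.Fin using (Fin)
open import Data.Vec using (Vec; lookup; _[_]≔_; foldr; map)
open import Data.Fin.Subset as S using (Subset)
open import Data.Product using (Σ; _×_; ∃)
open import Data.Sum using (_⊎_)
open import Relation.Binary.PropositionalEquality using (_≡_)
open import Relation.Nullary using (¬_)

-- X = Fin m, Y = Fin n.
-- A tableau f : X → Y, represented as a vector (identified with its graph).
Tableau : ℕ → ℕ → Set
Tableau m n = Vec (Fin n) m

-- A subset of X × Y : for each x, a subset of Y.
Cells : ℕ → ℕ → Set
Cells m n = Vec (Subset n) m

module _ {m n : ℕ} where

  infix 4 _∈ᶜ_ _∉ᶜ_ _⊆ᶜ_

  _∈ᶜ_ : Fin m × Fin n → Cells m n → Set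
  (x Data.Product., y) ∈ᶜ A = y S.∈ lookup A x

  _∉ᶜ_ : Fin m × Fin n → Cells m n → Set
  p ∉ᶜ A = ¬ (p ∈ᶜ A)

  _⊆ᶜ_ : Cells m n → Cells m n → Set
  A ⊆ᶜ B = ∀ x y → (x Data.Product., y) ∈ᶜ A → (x Data.Product., y) ∈ᶜ B

  _─ᶜ_ : Cells m n → Cells m n → Cells m n
  A ─ᶜ B = Data.Vec.zipWith S._─_ A B

  cardᶜ : Cells m n → ℕ
  cardᶜ A = foldr (λ _ → ℕ) _+_ 0 (map S.∣_∣ A)

  graph : Tableau m n → Cells m n
  graph f = Data.Vec.tabulate (λ x → S.⁅ lookup f x ⁆)

  -- A simplicial complex on the vertices v_(x,y), (x,y) ∈ E, is given by the
  -- predicate "is a face", where a face (set of vertices) is encoded by the set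
  -- of labels (x,y) of its vertices (v is injective, so this is faithful).
  Complex : Set₁
  Complex = Cells m n → Set

  IsFacet : Complex → Cells m n → Set
  IsFacet K G = K G × (∀ G' → K G' → G ⊆ᶜ G' → G' ≡ G)

  Pure : Complex → Set
  Pure K = ∀ G G' → IsFacet K G → IsFacet K G' → cardᶜ G ≡ cardᶜ G'

  del : Fin m × Fin n → Complex → Complex
  del p K G = K G × p ∉ᶜ G

  IsConeVertex : Complex → Fin m × Fin n → Set
  IsConeVertex K p = ∀ G → IsFacet K G → p ∈ᶜ G

  -- The tableau complex Δ(X,Y,T,E); T is given by its characteristic function.
  -- Faces: {v_e : e ∈ E \ F} for F ⊆ E containing (the graph of) some f ∈ T.
  TableauComplex : (Tableau m n → Bool) → Cells m n → Complex
  TableauComplex T E G =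
    Σ (Cells m n) λ F → F ⊆ᶜ E × (Σ (Tableau m n) λ f → T f ≡ true × graph f ⊆ᶜ F)
                       × G ≡ E ─ᶜ F

  IsSafe : (Tableau m n → Bool) → Fin m → Fin n → Set
  IsSafe T x y = ∀ f → T f ≡ true → T (f [ x ]≔ y) ≡ true

module Submission where

-- The tableau complex is generated by the graphs of the tableaux in T: its faces are the
-- complements E ∖ F of the sets F ⊆ E containing a generator, so its facets are the complements
-- of the inclusion-minimal generators, and it is pure exactly when these all have the same size.
-- Deleting v_(x,y) gives the complex generated by the sets graph f ∪ {(x,y)}, f ∈ T.  Such a set
-- has m cells if f(x) = y and m + 1 otherwise, and it is minimal exactly when f(x) = y or the
-- modified tableau f[x ↦ y] is not in T.  At a cone vertex no f ∈ T has f(x) = y, so all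
-- generators have m + 1 cells; at a safe vertex every minimal generator has m cells.  Conversely,
-- if some g ∈ T has g(x) = y and some f ∈ T has f[x ↦ y] ∉ T, the generators of g and f are
-- minimal of sizes m and m + 1.

open import Data.Bool using (Bool; true; false)
open import Data.Bool.Properties using (¬-not) renaming (_≟_ to _≟ᵇ_)
open import Data.Fin using (Fin; zero; suc)
open import Data.Fin.Properties using (any?; _≟_)
open import Data.Fin.Subset using (Subset; inside; outside; _∈_; _∉_; _⊆_; ⁅_⁆; _∪_; _─_; ∣_∣)
open import Data.Fin.Subset.Properties
  using (_∈?_; drop-∷-⊆; ⊆-antisym; x∈p∪q⁺; x∈p∪q⁻; x∈⁅x⁆; x∈⁅y⁆⇒x≡y; ∣⁅x⁆∣≡1; ∪-identityʳ;
         p─q⊆p; x∈p∧x∉q⇒x∈p─q)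
open import Data.Nat using (ℕ; zero; suc; _+_)
open import Data.Nat.Properties
  using (+-suc; +-cancelˡ-≡; +-cancelʳ-≡; 1+n≢n; +-commutativeSemigroup)
open import Algebra.Properties.CommutativeSemigroup +-commutativeSemigroup using (interchange)
open import Data.Product using (Σ; ∃; _×_; _,_; proj₁; proj₂)
open import Data.Sum using (_⊎_; inj₁; inj₂)
import Data.Sum as Sum
open import Data.Vec using (Vec; []; _∷_; here; there; lookup; _[_]≔_)
open import Data.Vec.Properties
  using (lookup∘update; lookup∘update′; []≔-lookup; lookup-zipWith; lookup∘tabulate)
open import Data.Vec.Relation.Binary.Pointwise.Extensional using (ext; Pointwise-≡⇒≡)
open import Function using (_∘_; id)
open import Function.Bundles using (_⇔_; mk⇔)
open import Function.Construct.Composition using (_⇔-∘_)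
open import Relation.Binary.PropositionalEquality
  using (_≡_; _≢_; refl; sym; trans; cong; cong₂; subst; module ≡-Reasoning)
open import Relation.Nullary using (Dec; yes; no; contradiction)
open import Relation.Nullary.Decidable using (map′; decidable-stable; _×-dec_)
open import Relation.Unary using (Decidable)

open import Defs

private
  variable
    k m n : ℕ

x∈p─q⇒x∉q : {x : Fin k} (p q : Subset k) → x ∈ p ─ q → x ∉ q
x∈p─q⇒x∉q (inside ∷ p) (outside ∷ q) here ()
x∈p─q⇒x∉q (_ ∷ p) (_ ∷ q) (there x∈p─q) (there x∈q) = x∈p─q⇒x∉q p q x∈p─q x∈q

∣p─q∣+∣q∣≡∣p∣ : (p q : Subset k) → q ⊆ p → ∣ p ─ q ∣ + ∣ q ∣ ≡ ∣ p ∣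
∣p─q∣+∣q∣≡∣p∣ []            []            _   = refl
∣p─q∣+∣q∣≡∣p∣ (outside ∷ p) (outside ∷ q) q⊆p = ∣p─q∣+∣q∣≡∣p∣ p q (drop-∷-⊆ q⊆p)
∣p─q∣+∣q∣≡∣p∣ (inside  ∷ p) (outside ∷ q) q⊆p = cong suc (∣p─q∣+∣q∣≡∣p∣ p q (drop-∷-⊆ q⊆p))
∣p─q∣+∣q∣≡∣p∣ (outside ∷ p) (inside  ∷ q) q⊆p = contradiction (q⊆p here) λ ()
∣p─q∣+∣q∣≡∣p∣ (inside  ∷ p) (inside  ∷ q) q⊆p =
  trans (+-suc ∣ p ─ q ∣ ∣ q ∣) (cong suc (∣p─q∣+∣q∣≡∣p∣ p q (drop-∷-⊆ q⊆p)))

x∉p⇒∣p∪⁅x⁆∣≡1+∣p∣ : (p : Subset k) (x : Fin k) → x ∉ p → ∣ p ∪ ⁅ x ⁆ ∣ ≡ suc ∣ p ∣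
x∉p⇒∣p∪⁅x⁆∣≡1+∣p∣ (outside ∷ p) zero    _   = cong (suc ∘ ∣_∣) (∪-identityʳ p)
x∉p⇒∣p∪⁅x⁆∣≡1+∣p∣ (inside  ∷ p) zero    x∉p = contradiction here x∉p
x∉p⇒∣p∪⁅x⁆∣≡1+∣p∣ (outside ∷ p) (suc x) x∉p = x∉p⇒∣p∪⁅x⁆∣≡1+∣p∣ p x (x∉p ∘ there)
x∉p⇒∣p∪⁅x⁆∣≡1+∣p∣ (inside  ∷ p) (suc x) x∉p = cong suc (x∉p⇒∣p∪⁅x⁆∣≡1+∣p∣ p x (x∉p ∘ there))

∃-tableau? : {P : Tableau m n → Set} → Decidable P → Dec (∃ P)
∃-tableau? {zero}  P? = map′ ([] ,_) (λ { ([] , p) → p }) (P? [])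
∃-tableau? {suc m} P? =
  map′ (λ (a , f , p) → a ∷ f , p) (λ { (a ∷ f , p) → a , f , p })
       (any? λ a → ∃-tableau? (P? ∘ (a ∷_)))

≡-[]≔ : ∀ {A : Set} (u v : Vec A k) (i : Fin k) →
        (∀ j → j ≢ i → lookup u j ≡ lookup v j) → u ≡ v [ i ]≔ lookup u i
≡-[]≔ u v i agree = Pointwise-≡⇒≡ (ext pointwise)
  where
  pointwise : ∀ j → lookup u j ≡ lookup (v [ i ]≔ lookup u i) j
  pointwise j with j ≟ i
  ... | yes refl = sym (lookup∘update i v (lookup u i))
  ... | no j≢i   = trans (agree j j≢i) (sym (lookup∘update′ j≢i v (lookup u i)))

[]≔-lookup-≡ : ∀ {A : Set} (u : Vec A k) {i : Fin k} {a : A} → lookup u i ≡ a → u [ i ]≔ a ≡ u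
[]≔-lookup-≡ u {i} refl = []≔-lookup u i

⊆ᶜ-trans : {A B C : Cells m n} → A ⊆ᶜ B → B ⊆ᶜ C → A ⊆ᶜ C
⊆ᶜ-trans A⊆B B⊆C x y = B⊆C x y ∘ A⊆B x y

⊆ᶜ-reflexive : {A B : Cells m n} → A ≡ B → A ⊆ᶜ B
⊆ᶜ-reflexive refl _ _ = id

⊆ᶜ-antisym : {A B : Cells m n} → A ⊆ᶜ B → B ⊆ᶜ A → A ≡ B
⊆ᶜ-antisym A⊆B B⊆A = Pointwise-≡⇒≡ (ext λ x → ⊆-antisym (A⊆B x _) (B⊆A x _))

∈ᶜ-─⁺ : (A B : Cells m n) {p : Fin m × Fin n} → p ∈ᶜ A → p ∉ᶜ B → p ∈ᶜ A ─ᶜ B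
∈ᶜ-─⁺ A B {x , y} y∈A y∉B =
  subst (y ∈_) (sym (lookup-zipWith _─_ x A B)) (x∈p∧x∉q⇒x∈p─q y∈A y∉B)

∈ᶜ-─⁻ : (A B : Cells m n) {p : Fin m × Fin n} → p ∈ᶜ A ─ᶜ B → p ∈ᶜ A × p ∉ᶜ B
∈ᶜ-─⁻ A B {x , y} y∈A─B =
  p─q⊆p (lookup A x) (lookup B x) y∈ , x∈p─q⇒x∉q (lookup A x) (lookup B x) y∈
  where
  y∈ : y ∈ lookup A x ─ lookup B x
  y∈ = subst (y ∈_) (lookup-zipWith _─_ x A B) y∈A─B

∉ᶜ-─⇒∈ᶜ : (A B : Cells m n) {p : Fin m × Fin n} → p ∈ᶜ A → p ∉ᶜ A ─ᶜ B → p ∈ᶜ B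
∉ᶜ-─⇒∈ᶜ A B {x , y} p∈A p∉A─B =
  decidable-stable (y ∈? lookup B x) (p∉A─B ∘ ∈ᶜ-─⁺ A B p∈A)

─ᶜ-antitone : (E : Cells m n) {F F′ : Cells m n} → F ⊆ᶜ F′ → E ─ᶜ F′ ⊆ᶜ E ─ᶜ F
─ᶜ-antitone E {F} {F′} F⊆F′ x y p∈E─F′ =
  let p∈E , p∉F′ = ∈ᶜ-─⁻ E F′ p∈E─F′ in ∈ᶜ-─⁺ E F p∈E (p∉F′ ∘ F⊆F′ x y)

─ᶜ-antitone⁻ : (E F F′ : Cells m n) → F′ ⊆ᶜ E → E ─ᶜ F ⊆ᶜ E ─ᶜ F′ → F′ ⊆ᶜ F
─ᶜ-antitone⁻ E F F′ F′⊆E E─F⊆E─F′ x y p∈F′ =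
  ∉ᶜ-─⇒∈ᶜ E F (F′⊆E x y p∈F′) λ p∈E─F → proj₂ (∈ᶜ-─⁻ E F′ (E─F⊆E─F′ x y p∈E─F)) p∈F′

cardᶜ-─ : (E F : Cells m n) → F ⊆ᶜ E → cardᶜ (E ─ᶜ F) + cardᶜ F ≡ cardᶜ E
cardᶜ-─ []      []      _   = refl
cardᶜ-─ (e ∷ E) (f ∷ F) F⊆E =
  trans (interchange (∣ e ─ f ∣) (cardᶜ (E ─ᶜ F)) (∣ f ∣) (cardᶜ F))
        (cong₂ _+_ (∣p─q∣+∣q∣≡∣p∣ e f (F⊆E zero _)) (cardᶜ-─ E F (F⊆E ∘ suc)))

∈ᶜ-graph⁺ : (f : Tableau m n) {x : Fin m} {y : Fin n} → lookup f x ≡ y → (x , y) ∈ᶜ graph f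
∈ᶜ-graph⁺ f {x} refl =
  subst (lookup f x ∈_) (sym (lookup∘tabulate (λ a → ⁅ lookup f a ⁆) x)) (x∈⁅x⁆ (lookup f x))

∈ᶜ-graph⁻ : (f : Tableau m n) {x : Fin m} {y : Fin n} → (x , y) ∈ᶜ graph f → lookup f x ≡ y
∈ᶜ-graph⁻ f {x} {y} y∈ =
  sym (x∈⁅y⁆⇒x≡y (lookup f x) (subst (y ∈_) (lookup∘tabulate (λ a → ⁅ lookup f a ⁆) x) y∈))

graph-⊆⇒≡ : (g f : Tableau m n) → graph g ⊆ᶜ graph f → g ≡ f
graph-⊆⇒≡ g f g⊆f = Pointwise-≡⇒≡ (ext λ x → sym (∈ᶜ-graph⁻ f (g⊆f x _ (∈ᶜ-graph⁺ g refl))))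

cardᶜ-graph : (f : Tableau m n) → cardᶜ (graph f) ≡ m
cardᶜ-graph []      = refl
cardᶜ-graph (a ∷ f) = cong₂ _+_ (∣⁅x⁆∣≡1 a) (cardᶜ-graph f)

insertᶜ : Fin m × Fin n → Cells m n → Cells m n
insertᶜ (x , y) A = A [ x ]≔ (lookup A x ∪ ⁅ y ⁆)

∈ᶜ-insertᶜ⁺ : (A : Cells m n) (p : Fin m × Fin n) {q : Fin m × Fin n} → q ∈ᶜ A → q ∈ᶜ insertᶜ p A
∈ᶜ-insertᶜ⁺ A (x , y) {a , b} b∈A with a ≟ x
... | yes refl = subst (b ∈_) (sym (lookup∘update x A _)) (x∈p∪q⁺ (inj₁ b∈A))
... | no a≢x   = subst (b ∈_) (sym (lookup∘update′ a≢x A _)) b∈A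

∈ᶜ-insertᶜ-self : (A : Cells m n) (p : Fin m × Fin n) → p ∈ᶜ insertᶜ p A
∈ᶜ-insertᶜ-self A (x , y) = subst (y ∈_) (sym (lookup∘update x A _)) (x∈p∪q⁺ (inj₂ (x∈⁅x⁆ y)))

∈ᶜ-insertᶜ⁻ : (A : Cells m n) (p : Fin m × Fin n) {q : Fin m × Fin n} →
              q ∈ᶜ insertᶜ p A → q ∈ᶜ A ⊎ q ≡ p
∈ᶜ-insertᶜ⁻ A (x , y) {a , b} b∈ with a ≟ x
... | yes refl = Sum.map id (cong (x ,_) ∘ x∈⁅y⁆⇒x≡y y)
                   (x∈p∪q⁻ (lookup A x) ⁅ y ⁆ (subst (b ∈_) (lookup∘update x A _) b∈))
... | no a≢x   = inj₁ (subst (b ∈_) (lookup∘update′ a≢x A _) b∈)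

insertᶜ-⊆ : (p : Fin m × Fin n) (A B : Cells m n) → A ⊆ᶜ B → p ∈ᶜ B → insertᶜ p A ⊆ᶜ B
insertᶜ-⊆ p A B A⊆B p∈B a b q∈ with ∈ᶜ-insertᶜ⁻ A p q∈
... | inj₁ q∈A  = A⊆B a b q∈A
... | inj₂ refl = p∈B

insertᶜ-∈ : (A : Cells m n) (p : Fin m × Fin n) → p ∈ᶜ A → insertᶜ p A ≡ A
insertᶜ-∈ A p p∈A = ⊆ᶜ-antisym (insertᶜ-⊆ p A A (λ _ _ → id) p∈A) (λ _ _ → ∈ᶜ-insertᶜ⁺ A p)

cardᶜ-insertᶜ-∉ : (A : Cells m n) (p : Fin m × Fin n) → p ∉ᶜ A → cardᶜ (insertᶜ p A) ≡ suc (cardᶜ A)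
cardᶜ-insertᶜ-∉ (r ∷ A) (zero  , y) y∉r = cong (_+ cardᶜ A) (x∉p⇒∣p∪⁅x⁆∣≡1+∣p∣ r y y∉r)
cardᶜ-insertᶜ-∉ (r ∷ A) (suc x , y) p∉A =
  trans (cong (∣ r ∣ +_) (cardᶜ-insertᶜ-∉ A (x , y) p∉A)) (+-suc ∣ r ∣ (cardᶜ A))

graph-[]≔⊆insertᶜ : (f : Tableau m n) (x : Fin m) (y : Fin n) →
                    graph (f [ x ]≔ y) ⊆ᶜ insertᶜ (x , y) (graph f)
graph-[]≔⊆insertᶜ f x y a b b∈ with a ≟ x
... | yes refl = subst (λ b → (x , b) ∈ᶜ insertᶜ (x , y) (graph f))
                   (trans (sym (lookup∘update x f y)) (∈ᶜ-graph⁻ (f [ x ]≔ y) b∈))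
                   (∈ᶜ-insertᶜ-self (graph f) (x , y))
... | no a≢x   = ∈ᶜ-insertᶜ⁺ (graph f) (x , y)
                   (∈ᶜ-graph⁺ f (trans (sym (lookup∘update′ a≢x f y)) (∈ᶜ-graph⁻ (f [ x ]≔ y) b∈)))

graph⊆insertᶜ⇒ : (g f : Tableau m n) (x : Fin m) (y : Fin n) →
                 graph g ⊆ᶜ insertᶜ (x , y) (graph f) → g ≡ f ⊎ g ≡ f [ x ]≔ y
graph⊆insertᶜ⇒ g f x y g⊆ = at-x (∈ᶜ-insertᶜ⁻ (graph f) (x , y) (g⊆ x _ (∈ᶜ-graph⁺ g refl)))
  where
  agree : ∀ a → a ≢ x → lookup g a ≡ lookup f a
  agree a a≢x with ∈ᶜ-insertᶜ⁻ (graph f) (x , y) (g⊆ a _ (∈ᶜ-graph⁺ g refl))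
  ... | inj₁ ga∈f = sym (∈ᶜ-graph⁻ f ga∈f)
  ... | inj₂ eq   = contradiction (cong proj₁ eq) a≢x

  open ≡-Reasoning

  at-x : (x , lookup g x) ∈ᶜ graph f ⊎ (x , lookup g x) ≡ (x , y) → g ≡ f ⊎ g ≡ f [ x ]≔ y
  at-x (inj₁ gx∈f) = inj₁ (begin
    g                   ≡⟨ ≡-[]≔ g f x agree ⟩
    f [ x ]≔ lookup g x ≡⟨ cong (f [ x ]≔_) (∈ᶜ-graph⁻ f gx∈f) ⟨
    f [ x ]≔ lookup f x ≡⟨ []≔-lookup f x ⟩
    f                   ∎)
  at-x (inj₂ gx≡y) = inj₂ (trans (≡-[]≔ g f x agree) (cong ((f [ x ]≔_) ∘ proj₂) gx≡y))

IsFacet-resp : {K L : Complex {m} {n}} → (∀ {G} → K G → L G) → (∀ {G} → L G → K G) →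
               ∀ {G} → IsFacet K G → IsFacet L G
IsFacet-resp K⇒L L⇒K (K-G , maximal) = K⇒L K-G , λ G′ L-G′ → maximal G′ (L⇒K L-G′)

Pure-resp : {K L : Complex {m} {n}} → (∀ {G} → K G → L G) → (∀ {G} → L G → K G) → Pure K → Pure L
Pure-resp K⇒L L⇒K pure G G′ facet facet′ =
  pure G G′ (IsFacet-resp L⇒K K⇒L facet) (IsFacet-resp L⇒K K⇒L facet′)

module _ {I : Set} (P : I → Set) (s : I → Cells m n) where

  IsMinimalGenerator : I → Set
  IsMinimalGenerator i = P i × (∀ j → P j → s j ⊆ᶜ s i → s i ⊆ᶜ s j)

  EquicardinalMinimalGenerators : Set
  EquicardinalMinimalGenerators =
    ∀ {i j} → IsMinimalGenerator i → IsMinimalGenerator j → cardᶜ (s i) ≡ cardᶜ (s j)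

  module _ (E : Cells m n) where

    -- TableauComplex T E is by definition Generated (λ f → T f ≡ true) graph E.
    Generated : Complex
    Generated G = Σ (Cells m n) λ F → F ⊆ᶜ E × (Σ I λ i → P i × s i ⊆ᶜ F) × G ≡ E ─ᶜ F

    module _ (s⊆E : ∀ i → P i → s i ⊆ᶜ E) where

      generator-face : ∀ {i} → P i → Generated (E ─ᶜ s i)
      generator-face {i} Pi = s i , s⊆E i Pi , (i , Pi , λ _ _ → id) , refl

      facet⇒minimalGenerator : ∀ {G} → IsFacet Generated G →
                               Σ I λ i → IsMinimalGenerator i × G ≡ E ─ᶜ s i
      facet⇒minimalGenerator ((F , _ , (i , Pi , sᵢ⊆F) , refl) , maximal) =
        i , (Pi , minimal) , sym E─sᵢ≡E─F
        where
        E─sᵢ≡E─F : E ─ᶜ s i ≡ E ─ᶜ F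
        E─sᵢ≡E─F = maximal (E ─ᶜ s i) (generator-face Pi) (─ᶜ-antitone E sᵢ⊆F)

        minimal : ∀ j → P j → s j ⊆ᶜ s i → s i ⊆ᶜ s j
        minimal j Pj sⱼ⊆sᵢ = ─ᶜ-antitone⁻ E (s j) (s i) (s⊆E i Pi) (⊆ᶜ-reflexive E─sⱼ≡E─sᵢ)
          where
          E─sⱼ≡E─sᵢ : E ─ᶜ s j ≡ E ─ᶜ s i
          E─sⱼ≡E─sᵢ = trans (maximal (E ─ᶜ s j) (generator-face Pj)
                                     (─ᶜ-antitone E (⊆ᶜ-trans {A = s j} {s i} {F} sⱼ⊆sᵢ sᵢ⊆F)))
                            (sym E─sᵢ≡E─F)

      minimalGenerator⇒facet : ∀ {i} → IsMinimalGenerator i → IsFacet Generated (E ─ᶜ s i)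
      minimalGenerator⇒facet {i} (Pi , minimal) = generator-face Pi , maximal
        where
        maximal : ∀ G → Generated G → E ─ᶜ s i ⊆ᶜ G → G ≡ E ─ᶜ s i
        maximal _ (F , F⊆E , (j , Pj , sⱼ⊆F) , refl) E─sᵢ⊆E─F = cong (E ─ᶜ_) (⊆ᶜ-antisym F⊆sᵢ sᵢ⊆F)
          where
          F⊆sᵢ : F ⊆ᶜ s i
          F⊆sᵢ = ─ᶜ-antitone⁻ E (s i) F F⊆E E─sᵢ⊆E─F
          sᵢ⊆F : s i ⊆ᶜ F
          sᵢ⊆F = ⊆ᶜ-trans {A = s i} {s j} {F}
                   (minimal j Pj (⊆ᶜ-trans {A = s j} {F} {s i} sⱼ⊆F F⊆sᵢ)) sⱼ⊆F

      pure⇔equicardinal : Pure Generated ⇔ EquicardinalMinimalGenerators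
      pure⇔equicardinal = mk⇔ pure⇒equicardinal equicardinal⇒pure
        where
        cardᶜ-complement : ∀ {i} → IsMinimalGenerator i → cardᶜ (E ─ᶜ s i) + cardᶜ (s i) ≡ cardᶜ E
        cardᶜ-complement {i} (Pi , _) = cardᶜ-─ E (s i) (s⊆E i Pi)

        pure⇒equicardinal : Pure Generated → EquicardinalMinimalGenerators
        pure⇒equicardinal pure {i} {j} min-i min-j = +-cancelˡ-≡ (cardᶜ (E ─ᶜ s i)) _ _ (begin
          cardᶜ (E ─ᶜ s i) + cardᶜ (s i) ≡⟨ cardᶜ-complement min-i ⟩
          cardᶜ E                        ≡⟨ cardᶜ-complement min-j ⟨
          cardᶜ (E ─ᶜ s j) + cardᶜ (s j) ≡⟨ cong (_+ cardᶜ (s j)) E─sᵢ≈E─sⱼ ⟨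
          cardᶜ (E ─ᶜ s i) + cardᶜ (s j) ∎)
          where
          open ≡-Reasoning
          E─sᵢ≈E─sⱼ : cardᶜ (E ─ᶜ s i) ≡ cardᶜ (E ─ᶜ s j)
          E─sᵢ≈E─sⱼ = pure _ _ (minimalGenerator⇒facet min-i) (minimalGenerator⇒facet min-j)

        equicardinal⇒pure : EquicardinalMinimalGenerators → Pure Generated
        equicardinal⇒pure equicardinal G G′ facet facet′
          with facet⇒minimalGenerator facet | facet⇒minimalGenerator facet′
        ... | i , min-i , refl | j , min-j , refl = +-cancelʳ-≡ (cardᶜ (s i)) _ _ (begin
          cardᶜ (E ─ᶜ s i) + cardᶜ (s i) ≡⟨ cardᶜ-complement min-i ⟩
          cardᶜ E                        ≡⟨ cardᶜ-complement min-j ⟨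
          cardᶜ (E ─ᶜ s j) + cardᶜ (s j) ≡⟨ cong (cardᶜ (E ─ᶜ s j) +_) (equicardinal min-i min-j) ⟨
          cardᶜ (E ─ᶜ s j) + cardᶜ (s i) ∎)
          where open ≡-Reasoning

module _ {I : Set} (P : I → Set) (s : I → Cells m n) (E : Cells m n) (p : Fin m × Fin n) where

  del-Generated⁺ : p ∈ᶜ E → ∀ {G} → del p (Generated P s E) G → Generated P (insertᶜ p ∘ s) E G
  del-Generated⁺ p∈E ((F , F⊆E , (i , Pi , sᵢ⊆F) , refl) , p∉E─F) =
    F , F⊆E , (i , Pi , insertᶜ-⊆ p (s i) F sᵢ⊆F (∉ᶜ-─⇒∈ᶜ E F p∈E p∉E─F)) , refl

  del-Generated⁻ : ∀ {G} → Generated P (insertᶜ p ∘ s) E G → del p (Generated P s E) G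
  del-Generated⁻ (F , F⊆E , (i , Pi , s⁺ᵢ⊆F) , refl) =
    (F , F⊆E , (i , Pi , λ a b → s⁺ᵢ⊆F a b ∘ ∈ᶜ-insertᶜ⁺ (s i) p) , refl) ,
    λ p∈E─F → proj₂ (∈ᶜ-─⁻ E F p∈E─F) (s⁺ᵢ⊆F _ _ (∈ᶜ-insertᶜ-self (s i) p))

  Pure-del⇔Pure-Generated : p ∈ᶜ E →
                            Pure (del p (Generated P s E)) ⇔ Pure (Generated P (insertᶜ p ∘ s) E)
  Pure-del⇔Pure-Generated p∈E = mk⇔ (Pure-resp (del-Generated⁺ p∈E) del-Generated⁻)
                                    (Pure-resp del-Generated⁻ (del-Generated⁺ p∈E))

module TableauDeletion (T : Tableau m n → Bool) (E : Cells m n)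
                       (T⊆E : ∀ f → T f ≡ true → graph f ⊆ᶜ E)
                       (x : Fin m) (y : Fin n) (xy∈E : (x , y) ∈ᶜ E) where

  InT : Tableau m n → Set
  InT f = T f ≡ true

  Δ : Complex
  Δ = TableauComplex T E

  InT⇒≢ : ∀ {f g} → InT f → T g ≡ false → f ≢ g
  InT⇒≢ Tf Tf≡false refl = contradiction (trans (sym Tf) Tf≡false) λ ()

  graph∪xy : Tableau m n → Cells m n
  graph∪xy = insertᶜ (x , y) ∘ graph

  graph∪xy⊆E : ∀ f → InT f → graph∪xy f ⊆ᶜ E
  graph∪xy⊆E f Tf = insertᶜ-⊆ (x , y) (graph f) E (T⊆E f Tf) xy∈E

  graph-minimal : ∀ {f} → InT f → IsMinimalGenerator InT graph f
  graph-minimal {f} Tf = Tf , λ g _ g⊆f → ⊆ᶜ-reflexive (cong graph (sym (graph-⊆⇒≡ g f g⊆f)))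

  cone⇒noTableauThrough : IsConeVertex Δ (x , y) → ∀ f → InT f → lookup f x ≢ y
  cone⇒noTableauThrough cone f Tf fx≡y =
    proj₂ (∈ᶜ-─⁻ E (graph f) (cone _ (minimalGenerator⇒facet InT graph E T⊆E (graph-minimal Tf))))
          (∈ᶜ-graph⁺ f fx≡y)

  noTableauThrough⇒cone : (∀ f → InT f → lookup f x ≢ y) → IsConeVertex Δ (x , y)
  noTableauThrough⇒cone none G facet with facet⇒minimalGenerator InT graph E T⊆E facet
  ... | f , (Tf , _) , refl = ∈ᶜ-─⁺ E (graph f) xy∈E (none f Tf ∘ ∈ᶜ-graph⁻ f)

  cardᶜ-graph∪xy-through : ∀ f → lookup f x ≡ y → cardᶜ (graph∪xy f) ≡ m
  cardᶜ-graph∪xy-through f fx≡y =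
    trans (cong cardᶜ (insertᶜ-∈ (graph f) (x , y) (∈ᶜ-graph⁺ f fx≡y))) (cardᶜ-graph f)

  cardᶜ-graph∪xy-avoid : ∀ f → lookup f x ≢ y → cardᶜ (graph∪xy f) ≡ suc m
  cardᶜ-graph∪xy-avoid f fx≢y =
    trans (cardᶜ-insertᶜ-∉ (graph f) (x , y) (fx≢y ∘ ∈ᶜ-graph⁻ f)) (cong suc (cardᶜ-graph f))

  Minimal : Tableau m n → Set
  Minimal = IsMinimalGenerator InT graph∪xy

  minimal-if : ∀ {f} → InT f → lookup f x ≡ y ⊎ T (f [ x ]≔ y) ≡ false → Minimal f
  minimal-if {f} Tf through-or-blocked = Tf , minimal
    where
    g≡f : ∀ {g} → InT g → lookup f x ≡ y ⊎ T (f [ x ]≔ y) ≡ false → g ≡ f ⊎ g ≡ f [ x ]≔ y → g ≡ f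
    g≡f _  _                (inj₁ g≡f)  = g≡f
    g≡f _  (inj₁ fx≡y)      (inj₂ g≡f′) = trans g≡f′ ([]≔-lookup-≡ f fx≡y)
    g≡f Tg (inj₂ Tf′≡false) (inj₂ g≡f′) = contradiction g≡f′ (InT⇒≢ Tg Tf′≡false)

    minimal : ∀ g → InT g → graph∪xy g ⊆ᶜ graph∪xy f → graph∪xy f ⊆ᶜ graph∪xy g
    minimal g Tg g⊆f = ⊆ᶜ-reflexive (cong graph∪xy (sym (g≡f Tg through-or-blocked
      (graph⊆insertᶜ⇒ g f x y (λ a b → g⊆f a b ∘ ∈ᶜ-insertᶜ⁺ (graph g) (x , y))))))

  minimal⇒through : ∀ {f} → InT (f [ x ]≔ y) → Minimal f → lookup f x ≡ y
  minimal⇒through {f} Tf′ (_ , minimal) = cell-is-xy (∈ᶜ-insertᶜ⁻ (graph f′) (x , y) fx∈f′∪xy)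
    where
    f′ : Tableau m n
    f′ = f [ x ]≔ y

    f′⊆f : graph∪xy f′ ⊆ᶜ graph∪xy f
    f′⊆f = insertᶜ-⊆ (x , y) (graph f′) (graph∪xy f) (graph-[]≔⊆insertᶜ f x y)
                     (∈ᶜ-insertᶜ-self (graph f) (x , y))

    fx∈f′∪xy : (x , lookup f x) ∈ᶜ graph∪xy f′
    fx∈f′∪xy = minimal f′ Tf′ f′⊆f x (lookup f x)
                 (∈ᶜ-insertᶜ⁺ (graph f) (x , y) (∈ᶜ-graph⁺ f refl))

    cell-is-xy : (x , lookup f x) ∈ᶜ graph f′ ⊎ (x , lookup f x) ≡ (x , y) → lookup f x ≡ y
    cell-is-xy (inj₁ fx∈f′)  = trans (sym (∈ᶜ-graph⁻ f′ fx∈f′)) (lookup∘update x f y)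
    cell-is-xy (inj₂ xfx≡xy) = cong proj₂ xfx≡xy

  Equicardinal : Set
  Equicardinal = EquicardinalMinimalGenerators InT graph∪xy

  cone⇒equicardinal : IsConeVertex Δ (x , y) → Equicardinal
  cone⇒equicardinal cone {f} {g} (Tf , _) (Tg , _) =
    trans (cardᶜ-graph∪xy-avoid f (avoids f Tf)) (sym (cardᶜ-graph∪xy-avoid g (avoids g Tg)))
    where
    avoids : ∀ f → InT f → lookup f x ≢ y
    avoids = cone⇒noTableauThrough cone

  safe⇒equicardinal : IsSafe T x y → Equicardinal
  safe⇒equicardinal safe {f} {g} min-f@(Tf , _) min-g@(Tg , _) =
    trans (cardᶜ-graph∪xy-through f (minimal⇒through (safe f Tf) min-f))
          (sym (cardᶜ-graph∪xy-through g (minimal⇒through (safe g Tg) min-g)))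

  through∧equicardinal⇒safe : ∀ {g} → InT g → lookup g x ≡ y → Equicardinal → IsSafe T x y
  through∧equicardinal⇒safe {g} Tg gx≡y equicardinal f Tf = ¬-not Tf′≢false
    where
    Tf′≢false : T (f [ x ]≔ y) ≢ false
    Tf′≢false Tf′≡false = 1+n≢n (begin
      suc m              ≡⟨ cardᶜ-graph∪xy-avoid f fx≢y ⟨
      cardᶜ (graph∪xy f) ≡⟨ equicardinal min-f min-g ⟩
      cardᶜ (graph∪xy g) ≡⟨ cardᶜ-graph∪xy-through g gx≡y ⟩
      m                  ∎)
      where
      open ≡-Reasoning
      fx≢y : lookup f x ≢ y
      fx≢y fx≡y = InT⇒≢ Tf Tf′≡false (sym ([]≔-lookup-≡ f fx≡y))
      min-f : Minimal f
      min-f = minimal-if Tf (inj₂ Tf′≡false)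
      min-g : Minimal g
      min-g = minimal-if Tg (inj₁ gx≡y)

  equicardinal⇒cone⊎safe : Equicardinal → IsConeVertex Δ (x , y) ⊎ IsSafe T x y
  equicardinal⇒cone⊎safe equicardinal
    with ∃-tableau? (λ g → (T g ≟ᵇ true) ×-dec (lookup g x ≟ y))
  ... | no ∄g               = inj₁ (noTableauThrough⇒cone λ f Tf fx≡y → ∄g (f , Tf , fx≡y))
  ... | yes (g , Tg , gx≡y) = inj₂ (through∧equicardinal⇒safe Tg gx≡y equicardinal)

  equicardinal⇔cone⊎safe : Equicardinal ⇔ (IsConeVertex Δ (x , y) ⊎ IsSafe T x y)
  equicardinal⇔cone⊎safe = mk⇔ equicardinal⇒cone⊎safe λ where
    (inj₁ cone) → cone⇒equicardinal cone
    (inj₂ safe) → safe⇒equicardinal safe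

proposition2p5 : (m n : ℕ) (T : Tableau m n → Bool) (E : Cells m n) →
    (∀ f → T f ≡ true → graph f ⊆ᶜ E) →
    (x : Fin m) (y : Fin n) → (x , y) ∈ᶜ E →
    Pure (del (x , y) (TableauComplex T E))
      ⇔ (IsConeVertex (TableauComplex T E) (x , y) ⊎ IsSafe T x y)
proposition2p5 m n T E T⊆E x y xy∈E =
  equicardinal⇔cone⊎safe
    ⇔-∘ (pure⇔equicardinal InT graph∪xy E graph∪xy⊆E
    ⇔-∘ Pure-del⇔Pure-Generated InT graph E (x , y) xy∈E)
  where open TableauDeletion T E T⊆E x y xy∈E
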